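{- Suppose a finite simple graph $G$ has $C_5$ or the net graph $N$ as a strict subgraph. Then $|E(J^k(G))|\to\infty$ as $k\to\infty$.
   Context: The jump graph $J(G)$ has vertex set $E(G)$, two vertices adjacent iff the corresponding edges of $G$ share no endpoint; $J^0(G)=G$, $J^k(G)=J(J^{k-1}(G))$. $C_5$ is the 5-cycle; the net graph $N$ is a triangle with one pendant edge at each of its three vertices. Graphs differing only by isolated vertices are regarded as equal, so a strict subgraph means a subgraph differing from $G$ by more than isolated vertices. -}

module Defs where

open import Data.Nat using (ℕ; zero; suc; _≤_; _<ᵇ_; _≡ᵇ_)
open import Data.Fin using (Fin; toℕ; _≟_)
open import Data.Bool using (Bool; true; false; _∧_; _∨_; not; if_then_else_)
open import Data.List using (List; []; _∷_; [_]; length; lookup; concatMap; allFin)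
open import Data.Bool.ListAction using (any)
open import Data.Product using (Σ; _×_; _,_; ∃-syntax)
open import Relation.Nullary using (¬_; ⌊_⌋)
open import Relation.Binary.PropositionalEquality using (_≡_)
open import Function.Definitions using (Injective)

record Graph : Set where
  constructor mkGraph
  field
    n   : ℕ
    adj : Fin n → Fin n → Bool
open Graph public

IsSimple : Graph → Set
IsSimple G = (∀ u v → adj G u v ≡ adj G v u) × (∀ u → adj G u u ≡ false)

edges : (G : Graph) → List (Fin (n G) × Fin (n G))
edges G = concatMap (λ i → concatMap (λ j →
  if (toℕ i <ᵇ toℕ j) ∧ adj G i j then [ (i , j) ] else []) (allFin (n G))) (allFin (n G))

edgeCount : Graph → ℕ
edgeCount G = length (edges G)

disjointE : {m : ℕ} → Fin m × Fin m → Fin m × Fin m → Bool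
disjointE (a , b) (c , d) =
  not (⌊ a ≟ c ⌋ ∨ ⌊ a ≟ d ⌋ ∨ ⌊ b ≟ c ⌋ ∨ ⌊ b ≟ d ⌋)

J : Graph → Graph
J G = mkGraph (length (edges G))
              (λ e f → disjointE (lookup (edges G) e) (lookup (edges G) f))

Jpow : ℕ → Graph → Graph
Jpow zero    G = G
Jpow (suc k) G = J (Jpow k G)

fromEdges : (m : ℕ) → List (ℕ × ℕ) → Graph
fromEdges m es = mkGraph m (λ i j → any (λ { (p , q) →
  ((toℕ i ≡ᵇ p) ∧ (toℕ j ≡ᵇ q)) ∨ ((toℕ i ≡ᵇ q) ∧ (toℕ j ≡ᵇ p)) }) es)

C5 : Graph
C5 = fromEdges 5 ((0 , 1) ∷ (1 , 2) ∷ (2 , 3) ∷ (3 , 4) ∷ (4 , 0) ∷ [])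

Net : Graph
Net = fromEdges 6 ((0 , 1) ∷ (1 , 2) ∷ (2 , 0) ∷ (0 , 3) ∷ (1 , 4) ∷ (2 , 5) ∷ [])

IsEmbedding : (H G : Graph) → (Fin (n H) → Fin (n G)) → Set
IsEmbedding H G f = Injective _≡_ _≡_ f ×
  (∀ a b → adj H a b ≡ true → adj G (f a) (f b) ≡ true)

-- H is a strict subgraph of G: a copy of H in G that misses some edge of G,
-- i.e. G differs from (the copy of) H by more than isolated vertices.
StrictSubgraph : Graph → Graph → Set
StrictSubgraph H G = Σ (Fin (n H) → Fin (n G)) λ f → IsEmbedding H G f ×
  Σ (Fin (n G)) λ u → Σ (Fin (n G)) λ v → adj G u v ≡ true ×
    ¬ (Σ (Fin (n H)) λ a → Σ (Fin (n H)) λ b → adj H a b ≡ true × f a ≡ u × f b ≡ v)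

EdgesDiverge : Graph → Set
EdgesDiverge G = ∀ (M : ℕ) → ∃[ K ] ∀ (k : ℕ) → K ≤ k → M ≤ edgeCount (Jpow k G)

-- J maps a pentagon to a pentagon: the sides {2p, 2p+1} (p mod 5) of a pentagon in H are
-- disjoint for consecutive p, so they span a pentagon, the pentagram, in J(H). An edge joining a
-- corner a of a pentagon to a vertex off it is a spoke at a. In J(H) a spoke is a vertex off the
-- pentagram adjacent to the three pentagram corners whose sides avoid a, so a jump turns m spokes
-- into at least m + 1; as distinct spokes are distinct edges, |E(Jᵏ(G))| ≥ k as soon as J(G) has
-- a pentagon with a spoke. If C₅ is a strict subgraph, the extra edge misses some side of the
-- pentagon and so is a spoke of the pentagram in J(G). For the net, J(N) ≅ N, and however the
-- extra edge meets the triangle of N, together with net edges it yields a pentagon with a spoke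
-- in J(G).

module Submission where

open import Defs
open import Algebra using (CommutativeMonoid)
import Data.Bool as Bool
open import Data.Bool using (Bool; true; false; not; T; _∧_; _∨_; if_then_else_)
open import Data.Bool.Properties using (∨-commutativeMonoid; T-≡)
open import Data.Empty using (⊥-elim)
open import Data.Fin using (Fin; suc; toℕ; inject₁; _≟_)
open import Data.Fin.Patterns using (0F; 1F; 2F; 3F; 4F; 5F)
open import Data.Fin.Properties using (toℕ-injective; all?; any?; injective⇒≤)
open import Data.List using ([]; [_]; lookup)
open import Data.List.Membership.Propositional using (_∈_)
open import Data.List.Membership.Propositional.Properties using (∈-concatMap⁺; ∈-allFin)
open import Data.List.Relation.Unary.Any as Any using (here)
open import Data.List.Relation.Unary.Any.Properties using (lookup-index)
open import Data.Nat using (ℕ; zero; suc; _<_; _≤_; z≤n; _<ᵇ_)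
open import Data.Nat.Properties using (<-cmp; <⇒<ᵇ; ≤-trans)
open import Data.Product using (Σ-syntax; ∃-syntax; _×_; _,_; proj₁; proj₂)
open import Data.Sum using (_⊎_; inj₁; inj₂)
open import Function using (id; _∘_; Injective)
open import Function.Bundles using (Equivalence)
open import Relation.Binary.Definitions using (tri<; tri≈; tri>)
open import Relation.Binary.PropositionalEquality
  using (_≡_; _≢_; ≢-sym; refl; sym; trans; cong; cong₂; subst)
open import Relation.Nullary using (¬_; Dec; yes; no; ⌊_⌋; contradiction)
open import Relation.Nullary.Decidable
  using (dec-true; dec-false; isYes≗does; from-yes; map′; ¬?; _×-dec_; _⊎-dec_; _→-dec_)
open import Relation.Nullary.Decidable using (False; toWitnessFalse)
open import Algebra.Properties.CommutativeSemigroup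
  (CommutativeMonoid.commutativeSemigroup ∨-commutativeMonoid) using (x∙yz≈y∙xz)

Undirected Loopless : Graph → Set
Undirected H = ∀ u v → adj H u v ≡ adj H v u
Loopless H = ∀ u → adj H u u ≡ false

adjacent⇒≢ : {H : Graph} → Loopless H → ∀ {u v} → adj H u v ≡ true → u ≢ v
adjacent⇒≢ {H} loopless {u} uv refl with () ← trans (sym (loopless u)) uv

record Edge (H : Graph) : Set where
  constructor edge
  field
    src tgt  : Fin (n H)
    adjacent : adj H src tgt ≡ true
open Edge

_∉ₑ_ : {H : Graph} → Fin (n H) → Edge H → Set
x ∉ₑ e = x ≢ src e × x ≢ tgt e

Disjoint SameEnds : {H : Graph} → Edge H → Edge H → Set
Disjoint e f = src e ∉ₑ f × tgt e ∉ₑ f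
SameEnds e f = (src e ≡ src f × tgt e ≡ tgt f) ⊎ (src e ≡ tgt f × tgt e ≡ src f)

data Distinct {H : Graph} (e f : Edge H) : Set where
  src∉ : src e ∉ₑ f → Distinct e f
  tgt∉ : tgt e ∉ₑ f → Distinct e f
  ∌src : src f ∉ₑ e → Distinct e f
  ∌tgt : tgt f ∉ₑ e → Distinct e f

distinct⇒¬sameEnds : {H : Graph} {e f : Edge H} → Distinct e f → ¬ SameEnds e f
distinct⇒¬sameEnds (src∉ (≢src , _))    (inj₁ (≡src , _)) = ≢src ≡src
distinct⇒¬sameEnds (src∉ (_ , ≢tgt))    (inj₂ (≡tgt , _)) = ≢tgt ≡tgt
distinct⇒¬sameEnds (tgt∉ (_ , ≢tgt))    (inj₁ (_ , ≡tgt)) = ≢tgt ≡tgt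
distinct⇒¬sameEnds (tgt∉ (≢src , _))    (inj₂ (_ , ≡src)) = ≢src ≡src
distinct⇒¬sameEnds (∌src (≢src , _))    (inj₁ (≡src , _)) = ≢src (sym ≡src)
distinct⇒¬sameEnds (∌src (_ , ≢tgt))    (inj₂ (_ , ≡src)) = ≢tgt (sym ≡src)
distinct⇒¬sameEnds (∌tgt (_ , ≢tgt))    (inj₁ (_ , ≡tgt)) = ≢tgt (sym ≡tgt)
distinct⇒¬sameEnds (∌tgt (≢src , _))    (inj₂ (≡tgt , _)) = ≢src (sym ≡tgt)

Represents : {H : Graph} → Fin (n H) × Fin (n H) → Edge H → Set
Represents p e = p ≡ (src e , tgt e) ⊎ p ≡ (tgt e , src e)

represents-unique : {H : Graph} {p : Fin (n H) × Fin (n H)} {e f : Edge H} →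
  Represents p e → Represents p f → SameEnds e f
represents-unique (inj₁ refl) (inj₁ refl) = inj₁ (refl , refl)
represents-unique (inj₁ refl) (inj₂ refl) = inj₂ (refl , refl)
represents-unique (inj₂ refl) (inj₁ refl) = inj₂ (refl , refl)
represents-unique (inj₂ refl) (inj₂ refl) = inj₁ (refl , refl)

∈-if-true : {A : Set} {b : Bool} (x : A) → b ≡ true → x ∈ (if b then [ x ] else [])
∈-if-true x refl = here refl

∈-edges : (H : Graph) {u v : Fin (n H)} → toℕ u < toℕ v → adj H u v ≡ true → (u , v) ∈ edges H
∈-edges H {u} {v} u<v uv =
  ∈-concatMap⁺ _ (Any.map (λ { refl → ∈-concatMap⁺ _ (Any.map (λ { refl → u,v∈ }) (∈-allFin v)) })
                          (∈-allFin u))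
  where
  u,v∈ : (u , v) ∈ (if (toℕ u <ᵇ toℕ v) ∧ adj H u v then [ (u , v) ] else [])
  u,v∈ = ∈-if-true (u , v) (cong₂ _∧_ (Equivalence.to T-≡ (<⇒<ᵇ u<v)) uv)

⌊⌋-true : {A : Set} (a? : Dec A) → A → ⌊ a? ⌋ ≡ true
⌊⌋-true a? a = trans (isYes≗does a?) (dec-true a? a)

⌊⌋-false : {A : Set} (a? : Dec A) → ¬ A → ⌊ a? ⌋ ≡ false
⌊⌋-false a? ¬a = trans (isYes≗does a?) (dec-false a? ¬a)

disjointE-true : {m : ℕ} {a b c d : Fin m} → a ≢ c → a ≢ d → b ≢ c → b ≢ d →
  disjointE (a , b) (c , d) ≡ true
disjointE-true {a = a} {b} {c} {d} a≢c a≢d b≢c b≢d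
  rewrite ⌊⌋-false (a ≟ c) a≢c | ⌊⌋-false (a ≟ d) a≢d
        | ⌊⌋-false (b ≟ c) b≢c | ⌊⌋-false (b ≟ d) b≢d
  = refl

disjointE-represents : {H : Graph} {p q : Fin (n H) × Fin (n H)} {e f : Edge H} →
  Represents p e → Represents q f → Disjoint e f → disjointE p q ≡ true
disjointE-represents (inj₁ refl) (inj₁ refl) ((ac , ad) , (bc , bd)) = disjointE-true ac ad bc bd
disjointE-represents (inj₁ refl) (inj₂ refl) ((ac , ad) , (bc , bd)) = disjointE-true ad ac bd bc
disjointE-represents (inj₂ refl) (inj₁ refl) ((ac , ad) , (bc , bd)) = disjointE-true bc bd ac ad
disjointE-represents (inj₂ refl) (inj₂ refl) ((ac , ad) , (bc , bd)) = disjointE-true bd bc ad ac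

⌊≟⌋-sym : {m : ℕ} (a c : Fin m) → ⌊ a ≟ c ⌋ ≡ ⌊ c ≟ a ⌋
⌊≟⌋-sym a c with a ≟ c
... | yes refl = sym (⌊⌋-true (a ≟ a) refl)
... | no a≢c = sym (⌊⌋-false (c ≟ a) (a≢c ∘ sym))

disjointE-comm : {m : ℕ} (p q : Fin m × Fin m) → disjointE p q ≡ disjointE q p
disjointE-comm (a , b) (c , d)
  rewrite ⌊≟⌋-sym a c | ⌊≟⌋-sym a d | ⌊≟⌋-sym b c | ⌊≟⌋-sym b d
  = cong not (cong (⌊ c ≟ a ⌋ ∨_) (x∙yz≈y∙xz ⌊ d ≟ a ⌋ ⌊ c ≟ b ⌋ ⌊ d ≟ b ⌋))

disjointE-irreflexive : {m : ℕ} (p : Fin m × Fin m) → disjointE p p ≡ false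
disjointE-irreflexive (a , b) rewrite ⌊⌋-true (a ≟ a) refl = refl

J-simple : (H : Graph) → IsSimple (J H)
J-simple H = (λ e f → disjointE-comm (lookup (edges H) e) (lookup (edges H) f))
           , (λ e → disjointE-irreflexive (lookup (edges H) e))

Jpow-simple : {G : Graph} → IsSimple G → ∀ k → IsSimple (Jpow k G)
Jpow-simple G-simple zero    = G-simple
Jpow-simple G-simple (suc k) = J-simple (Jpow k _)

Uncovered : (F : Graph) {m : ℕ} → (Fin (n F) → Fin m) → Fin m → Fin m → Set
Uncovered F f u v =
  ¬ (Σ[ a ∈ Fin (n F) ] Σ[ b ∈ Fin (n F) ] adj F a b ≡ true × f a ≡ u × f b ≡ v)

uncovered-∘ : {E F : Graph} {m : ℕ} {σ : Fin (n E) → Fin (n F)} {f : Fin (n F) → Fin m}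
  {u v : Fin m} →   IsEmbedding E F σ → Uncovered F f u v → Uncovered E (f ∘ σ) u v
uncovered-∘ {σ = σ} (_ , σ-adjacent) uncovered (a , b , ab , fσa≡u , fσb≡v) =
  uncovered (σ a , σ b , σ-adjacent a b ab , fσa≡u , fσb≡v)

uncovered-swap : {F : Graph} {m : ℕ} {f : Fin (n F) → Fin m} {u v : Fin m} →
  Undirected F → Uncovered F f u v → Uncovered F f v u
uncovered-swap undirected uncovered (a , b , ab , fa≡v , fb≡u) =
  uncovered (b , a , trans (undirected b a) ab , fb≡u , fa≡v)

IsEmbedding-∘ : {E F G : Graph} {g : Fin (n F) → Fin (n G)} {f : Fin (n E) → Fin (n F)} →
  IsEmbedding F G g → IsEmbedding E F f → IsEmbedding E G (g ∘ f)
IsEmbedding-∘ (g-injective , g-adjacent) (f-injective , f-adjacent) =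
  f-injective ∘ g-injective , λ a b → g-adjacent _ _ ∘ f-adjacent a b

isEmbedding? : (F G : Graph) (f : Fin (n F) → Fin (n G)) → Dec (IsEmbedding F G f)
isEmbedding? F G f =
  map′ (λ (inj , hom) → (λ {a} {b} → inj a b) , hom) (λ (inj , hom) → (λ _ _ → inj) , hom)
  ((all? λ a → all? λ b → (f a ≟ f b) →-dec (a ≟ b)) ×-dec
   (all? λ a → all? λ b → (adj F a b Bool.≟ true) →-dec (adj G (f a) (f b) Bool.≟ true)))

-- The side {2p, 2p+1} of C₅ is {double p, next (double p)}.
next double : Fin 5 → Fin 5
next 0F = 1F
next 1F = 2F
next 2F = 3F
next 3F = 4F
next 4F = 0F
double 0F = 0F
double 1F = 2F
double 2F = 4F
double 3F = 1F
double 4F = 3F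

opaque
  within-two-steps : ∀ i j →
    i ≡ j ⊎ j ≡ next i ⊎ i ≡ next j ⊎ j ≡ next (next i) ⊎ i ≡ next (next j)
  within-two-steps = from-yes (all? λ i → all? λ j →
    i ≟ j ⊎-dec j ≟ next i ⊎-dec i ≟ next j ⊎-dec j ≟ next (next i) ⊎-dec i ≟ next (next j))

Avoids : Fin 5 → Fin 5 → Set
Avoids p a = a ≢ double p × a ≢ next (double p)

avoids? : ∀ p a → Dec (Avoids p a)
avoids? p a = ¬? (a ≟ double p) ×-dec ¬? (a ≟ next (double p))

opaque
  pentagram-consecutive : ∀ p → Avoids (next p) (double p) × Avoids (next p) (next (double p))
  pentagram-consecutive =
    from-yes (all? λ p → avoids? (next p) (double p) ×-dec avoids? (next p) (next (double p)))

  pentagram-skip : ∀ p → Avoids (next (next p)) (next (double p))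
  pentagram-skip = from-yes (all? λ p → avoids? (next (next p)) (next (double p)))

  side-avoiding : ∀ a b → ∃[ p ] Avoids p a × Avoids p b
  side-avoiding = from-yes (all? λ a → all? λ b → any? λ p → avoids? p a ×-dec avoids? p b)

  two-sides-avoiding : ∀ a → ∃[ p ] ∃[ q ] p ≢ q × Avoids p a × Avoids q a
  two-sides-avoiding =
    from-yes (all? λ a → any? λ p → any? λ q → ¬? (p ≟ q) ×-dec avoids? p a ×-dec avoids? q a)

record Pentagon (H : Graph) : Set where
  field
    corner           : Fin 5 → Fin (n H)
    corner-injective : Injective _≡_ _≡_ corner
    side-adjacent    : ∀ i → adj H (corner i) (corner (next i)) ≡ true

  side : Fin 5 → Edge H
  side i = edge (corner i) (corner (next i)) (side-adjacent i)

  -- When u is not a corner, any a will do.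
  position : ∀ u → Σ[ a ∈ Fin 5 ] (∀ i → corner i ≡ u → i ≡ a)
  position u with any? (λ i → corner i ≟ u)
  ... | yes (a , a↦u) = a , λ i i↦u → corner-injective (trans i↦u (sym a↦u))
  ... | no  u-off     = 0F , λ i i↦u → ⊥-elim (u-off (i , i↦u))

  ∉side : ∀ p {u a} → (∀ i → corner i ≡ u → i ≡ a) → Avoids p a → u ∉ₑ side (double p)
  ∉side _ only-at (a≢ , a≢′) = (λ u≡ → a≢ (sym (only-at _ (sym u≡))))
                           , (λ u≡ → a≢′ (sym (only-at _ (sym u≡))))

  corner∉side : ∀ p {a} → Avoids p a → corner a ∉ₑ side (double p)
  corner∉side p = ∉side p λ _ → corner-injective

pentagon-fromClosedWalk : {H : Graph} → Loopless H → (c : Fin 5 → Fin (n H)) →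
  (∀ i → adj H (c i) (c (next i)) ≡ true) → (∀ i → c i ≢ c (next (next i))) → Pentagon H
pentagon-fromClosedWalk {H} loopless c step skip = record
  { corner = c ; corner-injective = injective ; side-adjacent = step }
  where
  injective : Injective _≡_ _≡_ c
  injective {i} {j} ci≡cj with within-two-steps i j
  ... | inj₁ i≡j                       = i≡j
  ... | inj₂ (inj₁ refl)               = ⊥-elim (adjacent⇒≢ {H} loopless (step i) ci≡cj)
  ... | inj₂ (inj₂ (inj₁ refl))        = ⊥-elim (adjacent⇒≢ {H} loopless (step j) (sym ci≡cj))
  ... | inj₂ (inj₂ (inj₂ (inj₁ refl))) = ⊥-elim (skip i ci≡cj)
  ... | inj₂ (inj₂ (inj₂ (inj₂ refl))) = ⊥-elim (skip j (sym ci≡cj))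

record SpokedPentagon (m : ℕ) (H : Graph) : Set where
  field
    pentagon : Pentagon H
  open Pentagon pentagon
  field
    tip             : Fin m → Fin (n H)
    foot            : Fin m → Fin 5
    tip-off         : ∀ t i → tip t ≢ corner i
    spoke-adjacent  : ∀ t → adj H (tip t) (corner (foot t)) ≡ true
    spokes-distinct : ∀ t u → tip t ≡ tip u → foot t ≡ foot u → t ≡ u

  spoke : Fin m → Edge H
  spoke t = edge (tip t) (corner (foot t)) (spoke-adjacent t)

singleSpoke : {H : Graph} (P : Pentagon H) (w : Fin (n H)) → (∀ i → w ≢ Pentagon.corner P i) →
  (j : Fin 5) → adj H w (Pentagon.corner P j) ≡ true → SpokedPentagon 1 H
singleSpoke P w w-off j w-adjacent = record
  { pentagon = P ; tip = λ _ → w ; foot = λ _ → j ; tip-off = λ _ → w-off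
  ; spoke-adjacent = λ _ → w-adjacent ; spokes-distinct = λ { 0F 0F _ _ → refl } }

opaque
  C5-next : ∀ i → adj C5 i (next i) ≡ true
  C5-next = from-yes (all? λ i → adj C5 i (next i) Bool.≟ true)

  C5-previous : ∀ i → adj C5 (next i) i ≡ true
  C5-previous = from-yes (all? λ i → adj C5 (next i) i Bool.≟ true)

rotate reflect : Fin 6 → Fin 6
rotate 0F = 1F
rotate 1F = 2F
rotate 2F = 0F
rotate 3F = 4F
rotate 4F = 5F
rotate 5F = 3F
reflect 0F = 0F
reflect 1F = 2F
reflect 2F = 1F
reflect 3F = 3F
reflect 4F = 5F
reflect 5F = 4F

turn : Fin 3 → Fin 6 → Fin 6
turn 0F = id
turn 1F = rotate
turn 2F = rotate ∘ rotate

triangle : Fin 3 → Fin 6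
triangle t = turn t 0F

opaque
  Net-undirected : Undirected Net
  Net-undirected = from-yes (all? λ a → all? λ b → adj Net a b Bool.≟ adj Net b a)

  turn-automorphism : ∀ t → IsEmbedding Net Net (turn t)
  turn-automorphism 0F = from-yes (isEmbedding? Net Net (turn 0F))
  turn-automorphism 1F = from-yes (isEmbedding? Net Net (turn 1F))
  turn-automorphism 2F = from-yes (isEmbedding? Net Net (turn 2F))

  reflect-automorphism : IsEmbedding Net Net reflect
  reflect-automorphism = from-yes (isEmbedding? Net Net reflect)

module Jump {H : Graph} (simple : IsSimple H) where

  edgeIndex : (e : Edge H) → Σ[ k ∈ Fin (edgeCount H) ] Represents (lookup (edges H) k) e
  edgeIndex (edge u v uv) with <-cmp (toℕ u) (toℕ v)
  ... | tri< u<v _ _ = let u,v∈ = ∈-edges H u<v uv in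
                       Any.index u,v∈ , inj₁ (sym (lookup-index u,v∈))
  ... | tri≈ _ u≡v _ = ⊥-elim (adjacent⇒≢ (proj₂ simple) uv (toℕ-injective u≡v))
  ... | tri> _ _ v<u = let v,u∈ = ∈-edges H v<u (trans (proj₁ simple v u) uv) in
                       Any.index v,u∈ , inj₂ (sym (lookup-index v,u∈))

  vertexJ : Edge H → Fin (n (J H))
  vertexJ e = proj₁ (edgeIndex e)

  vertexJ-injective : {e f : Edge H} → vertexJ e ≡ vertexJ f → SameEnds e f
  vertexJ-injective {e} {f} eq = represents-unique {e = e} {f = f}
    (subst (λ k → Represents (lookup (edges H) k) e) eq (proj₂ (edgeIndex e))) (proj₂ (edgeIndex f))

  vertexJ-distinct : {e f : Edge H} → Distinct e f → vertexJ e ≢ vertexJ f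
  vertexJ-distinct {e} {f} e≠f = distinct⇒¬sameEnds {e = e} {f = f} e≠f ∘ vertexJ-injective

  vertexJ-adjacent : {e f : Edge H} → Disjoint e f → adj (J H) (vertexJ e) (vertexJ f) ≡ true
  vertexJ-adjacent {e} {f} =
    disjointE-represents {e = e} {f = f} (proj₂ (edgeIndex e)) (proj₂ (edgeIndex f))

  pentagonJ : (e : Fin 5 → Edge H) → (∀ i → Disjoint (e i) (e (next i))) →
    (∀ i → Distinct (e i) (e (next (next i)))) → Pentagon (J H)
  pentagonJ e disjoint distinct = pentagon-fromClosedWalk (proj₂ (J-simple H)) (vertexJ ∘ e)
    (λ i → vertexJ-adjacent {e i} {e (next i)} (disjoint i))
    (λ i → vertexJ-distinct {e i} {e (next (next i))} (distinct i))

  pentagram : Pentagon H → Pentagon (J H)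
  pentagram P = pentagonJ (side ∘ double)
    (λ p → corner∉side (next p) (proj₁ (pentagram-consecutive p))
         , corner∉side (next p) (proj₂ (pentagram-consecutive p)))
    (λ p → tgt∉ (corner∉side (next (next p)) (pentagram-skip p)))
    where open Pentagon P

  module _ {m : ℕ} (S : SpokedPentagon m H) where
    open SpokedPentagon S
    open Pentagon pentagon

    spokeJ-injective : ∀ {t u} → vertexJ (spoke t) ≡ vertexJ (spoke u) →
      tip t ≡ tip u × foot t ≡ foot u
    spokeJ-injective {t} {u} eq with vertexJ-injective {spoke t} {spoke u} eq
    ... | inj₁ (tip≡tip , corner≡corner) = tip≡tip , corner-injective corner≡corner
    ... | inj₂ (tip≡corner , _)          = ⊥-elim (tip-off t (foot u) tip≡corner)

    spokes≤edgeCount : m ≤ edgeCount H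
    spokes≤edgeCount = injective⇒≤ λ {t} {u} eq →
      spokes-distinct t u (proj₁ (spokeJ-injective eq)) (proj₂ (spokeJ-injective eq))

    spokeJ-off : ∀ t i → vertexJ (spoke t) ≢ Pentagon.corner (pentagram pentagon) i
    spokeJ-off t i eq with vertexJ-injective {spoke t} {side (double i)} eq
    ... | inj₁ (tip≡corner , _) = tip-off t _ tip≡corner
    ... | inj₂ (tip≡corner , _) = tip-off t _ tip≡corner

    spokeJ-adjacent : ∀ t {p} → Avoids p (foot t) →
      adj (J H) (vertexJ (spoke t)) (Pentagon.corner (pentagram pentagon) p) ≡ true
    spokeJ-adjacent t {p} foot-avoided = vertexJ-adjacent {spoke t} {side (double p)}
      ((tip-off t _ , tip-off t _) , corner∉side p foot-avoided)

  -- Of the three pentagram corners whose sides avoid the foot of a spoke, the first spoke uses two.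
  spokedPentagonJ : {m : ℕ} → SpokedPentagon (suc m) H → SpokedPentagon (suc (suc m)) (J H)
  spokedPentagonJ {m} S = record
    { pentagon        = pentagram pentagon
    ; tip             = vertexJ ∘ spoke ∘ origin
    ; foot            = foot′
    ; tip-off         = spokeJ-off S ∘ origin
    ; spoke-adjacent  = adjacent′
    ; spokes-distinct = distinct′
    }
    where
    open SpokedPentagon S

    origin : Fin (suc (suc m)) → Fin (suc m)
    origin 0F      = 0F
    origin (suc t) = t

    first second : Fin 5 → Fin 5
    first a  = proj₁ (two-sides-avoiding a)
    second a = proj₁ (proj₂ (two-sides-avoiding a))

    first≢second : ∀ a → first a ≢ second a
    first≢second a = proj₁ (proj₂ (proj₂ (two-sides-avoiding a)))

    first-avoids : ∀ a → Avoids (first a) a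
    first-avoids a = proj₁ (proj₂ (proj₂ (proj₂ (two-sides-avoiding a))))

    second-avoids : ∀ a → Avoids (second a) a
    second-avoids a = proj₂ (proj₂ (proj₂ (proj₂ (two-sides-avoiding a))))

    foot′ : Fin (suc (suc m)) → Fin 5
    foot′ 0F      = second (foot 0F)
    foot′ (suc t) = first (foot t)

    adjacent′ : ∀ t →
      adj (J H) (vertexJ (spoke (origin t))) (Pentagon.corner (pentagram pentagon) (foot′ t)) ≡ true
    adjacent′ 0F      = spokeJ-adjacent S 0F (second-avoids (foot 0F))
    adjacent′ (suc t) = spokeJ-adjacent S t (first-avoids (foot t))

    distinct′ : ∀ t u → vertexJ (spoke (origin t)) ≡ vertexJ (spoke (origin u)) →
      foot′ t ≡ foot′ u → t ≡ u
    distinct′ 0F      0F      _  _     = refl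
    distinct′ 0F      (suc u) eq feet≡ =
      ⊥-elim (first≢second (foot 0F) (trans (cong first (proj₂ (spokeJ-injective S eq))) (sym feet≡)))
    distinct′ (suc t) 0F      eq feet≡ =
      ⊥-elim (first≢second (foot 0F) (trans (cong first (sym (proj₂ (spokeJ-injective S eq)))) feet≡))
    distinct′ (suc t) (suc u) eq _     =
      cong suc (spokes-distinct t u (proj₁ (spokeJ-injective S eq)) (proj₂ (spokeJ-injective S eq)))

  spokedPentagon-C5 : StrictSubgraph C5 H → SpokedPentagon 1 (J H)
  spokedPentagon-C5 (f , (f-injective , f-adjacent) , u , v , uv , uncovered) =
    singleSpoke (pentagram P) (vertexJ e) e-off p (vertexJ-adjacent {e} {side (double p)} (u∉ , v∉))
    where
    P : Pentagon H
    P = record { corner = f ; corner-injective = f-injective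
               ; side-adjacent = λ i → f-adjacent i (next i) (C5-next i) }
    open Pentagon P

    e : Edge H
    e = edge u v uv

    e-off : ∀ i → vertexJ e ≢ Pentagon.corner (pentagram P) i
    e-off i eq with vertexJ-injective {e} {side (double i)} eq
    ... | inj₁ (u≡ , v≡) =
      uncovered (double i , next (double i) , C5-next (double i) , sym u≡ , sym v≡)
    ... | inj₂ (u≡ , v≡) =
      uncovered (next (double i) , double i , C5-previous (double i) , sym u≡ , sym v≡)

    p : Fin 5
    p = proj₁ (side-avoiding (proj₁ (position u)) (proj₁ (position v)))

    u∉ : u ∉ₑ side (double p)
    u∉ = ∉side p (proj₂ (position u)) (proj₁ (proj₂ (side-avoiding _ _)))

    v∉ : v ∉ₑ side (double p)
    v∉ = ∉side p (proj₂ (position v)) (proj₂ (proj₂ (side-avoiding _ _)))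

  spokedPentagon-fromEdges : (e : Fin 5 → Edge H) → (∀ i → Disjoint (e i) (e (next i))) →
    (∀ i → Distinct (e i) (e (next (next i)))) → (w : Edge H) → (∀ i → Distinct w (e i)) →
    ∀ j → Disjoint w (e j) → SpokedPentagon 1 (J H)
  spokedPentagon-fromEdges e disjoint distinct w w-distinct j w-disjoint =
    singleSpoke (pentagonJ e disjoint distinct) (vertexJ w)
      (λ i → vertexJ-distinct {w} {e i} (w-distinct i)) j (vertexJ-adjacent {w} {e j} w-disjoint)

  module NetCopy {q : Fin 6 → Fin (n H)} (q-net : IsEmbedding Net H q) where

    q≢ : ∀ a b {a≢b : False (a ≟ b)} → q a ≢ q b
    q≢ a b {a≢b} = toWitnessFalse a≢b ∘ proj₁ q-net

    netEdge : ∀ a b {ab : T (adj Net a b)} → Edge H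
    netEdge a b {ab} = edge (q a) (q b) (proj₂ q-net a b (Equivalence.to T-≡ ab))

    awayFromTriangle : (e : Edge H) →
      (∀ t → q (triangle t) ≢ src e) → (∀ t → q (triangle t) ≢ tgt e) → SpokedPentagon 1 (J H)
    awayFromTriangle e u-off v-off = spokedPentagon-fromEdges cycle disjoint distinct
      (netEdge 0F 3F) spoke-distinct 3F ((q≢ 0F 1F , q≢ 0F 4F) , (q≢ 3F 1F , q≢ 3F 4F))
      where
      u≢ : ∀ t → src e ≢ q (triangle t)
      u≢ = ≢-sym ∘ u-off

      v≢ : ∀ t → tgt e ≢ q (triangle t)
      v≢ = ≢-sym ∘ v-off

      cycle : Fin 5 → Edge H
      cycle 0F = e
      cycle 1F = netEdge 0F 1F
      cycle 2F = netEdge 2F 5F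
      cycle 3F = netEdge 1F 4F
      cycle 4F = netEdge 2F 0F

      disjoint : ∀ i → Disjoint (cycle i) (cycle (next i))
      disjoint 0F = (u≢ 0F , u≢ 1F) , (v≢ 0F , v≢ 1F)
      disjoint 1F = (q≢ 0F 2F , q≢ 0F 5F) , (q≢ 1F 2F , q≢ 1F 5F)
      disjoint 2F = (q≢ 2F 1F , q≢ 2F 4F) , (q≢ 5F 1F , q≢ 5F 4F)
      disjoint 3F = (q≢ 1F 2F , q≢ 1F 0F) , (q≢ 4F 2F , q≢ 4F 0F)
      disjoint 4F = (u-off 2F , v-off 2F) , (u-off 0F , v-off 0F)

      distinct : ∀ i → Distinct (cycle i) (cycle (next (next i)))
      distinct 0F = ∌src (u-off 2F , v-off 2F)
      distinct 1F = src∉ (q≢ 0F 1F , q≢ 0F 4F)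
      distinct 2F = tgt∉ (q≢ 5F 2F , q≢ 5F 0F)
      distinct 3F = src∉ (u-off 1F , v-off 1F)
      distinct 4F = src∉ (q≢ 2F 0F , q≢ 2F 1F)

      spoke-distinct : ∀ i → Distinct (netEdge 0F 3F) (cycle i)
      spoke-distinct 0F = src∉ (u-off 0F , v-off 0F)
      spoke-distinct 1F = tgt∉ (q≢ 3F 0F , q≢ 3F 1F)
      spoke-distinct 2F = src∉ (q≢ 0F 2F , q≢ 0F 5F)
      spoke-distinct 3F = src∉ (q≢ 0F 1F , q≢ 0F 4F)
      spoke-distinct 4F = tgt∉ (q≢ 3F 2F , q≢ 3F 0F)

    pendantCornerEdge : ∀ {y} → adj H (q 0F) y ≡ true → Uncovered Net q (q 0F) y → q 4F ≢ y →
      SpokedPentagon 1 (J H)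
    pendantCornerEdge {y} y-adjacent uncovered q4≢y = spokedPentagon-fromEdges cycle disjoint distinct
      (netEdge 0F 1F) spoke-distinct 3F ((q≢ 0F 2F , q≢ 0F 5F) , (q≢ 1F 2F , q≢ 1F 5F))
      where
      y-off : ∀ (a : Fin 5) → q (inject₁ a) ≢ y
      y-off 0F = adjacent⇒≢ {H} (proj₂ simple) y-adjacent
      y-off 1F = λ q1≡y → uncovered (0F , 1F , refl , refl , q1≡y)
      y-off 2F = λ q2≡y → uncovered (0F , 2F , refl , refl , q2≡y)
      y-off 3F = λ q3≡y → uncovered (0F , 3F , refl , refl , q3≡y)
      y-off 4F = q4≢y

      y≢ : ∀ a → y ≢ q (inject₁ a)
      y≢ = ≢-sym ∘ y-off

      cycle : Fin 5 → Edge H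
      cycle 0F = edge (q 0F) y y-adjacent
      cycle 1F = netEdge 1F 2F
      cycle 2F = netEdge 0F 3F
      cycle 3F = netEdge 2F 5F
      cycle 4F = netEdge 1F 4F

      disjoint : ∀ i → Disjoint (cycle i) (cycle (next i))
      disjoint 0F = (q≢ 0F 1F , q≢ 0F 2F) , (y≢ 1F , y≢ 2F)
      disjoint 1F = (q≢ 1F 0F , q≢ 1F 3F) , (q≢ 2F 0F , q≢ 2F 3F)
      disjoint 2F = (q≢ 0F 2F , q≢ 0F 5F) , (q≢ 3F 2F , q≢ 3F 5F)
      disjoint 3F = (q≢ 2F 1F , q≢ 2F 4F) , (q≢ 5F 1F , q≢ 5F 4F)
      disjoint 4F = (q≢ 1F 0F , y-off 1F) , (q≢ 4F 0F , y-off 4F)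

      distinct : ∀ i → Distinct (cycle i) (cycle (next (next i)))
      distinct 0F = tgt∉ (y≢ 0F , y≢ 3F)
      distinct 1F = src∉ (q≢ 1F 2F , q≢ 1F 5F)
      distinct 2F = src∉ (q≢ 0F 1F , q≢ 0F 4F)
      distinct 3F = src∉ (q≢ 2F 0F , y-off 2F)
      distinct 4F = tgt∉ (q≢ 4F 1F , q≢ 4F 2F)

      spoke-distinct : ∀ i → Distinct (netEdge 0F 1F) (cycle i)
      spoke-distinct 0F = tgt∉ (q≢ 1F 0F , y-off 1F)
      spoke-distinct 1F = src∉ (q≢ 0F 1F , q≢ 0F 2F)
      spoke-distinct 2F = tgt∉ (q≢ 1F 0F , q≢ 1F 3F)
      spoke-distinct 3F = src∉ (q≢ 0F 2F , q≢ 0F 5F)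
      spoke-distinct 4F = src∉ (q≢ 0F 1F , q≢ 0F 4F)

  -- Up to a symmetry of the net the corner is 0, and the far end of the new edge, which cannot be
  -- both pendants 4 and 5, is not 4.
  triangleCornerEdge : ∀ {q} → IsEmbedding Net H q → ∀ t {v} → adj H (q (triangle t)) v ≡ true →
    Uncovered Net q (q (triangle t)) v → SpokedPentagon 1 (J H)
  triangleCornerEdge {q} q-net t {v} uv uncovered with v ≟ q (turn t 4F)
  ... | no v≢q4  =
    NetCopy.pendantCornerEdge (IsEmbedding-∘ {Net} {Net} {H} q-net (turn-automorphism t)) uv
      (uncovered-∘ {Net} {Net} (turn-automorphism t) uncovered) (≢-sym v≢q4)
  ... | yes refl =
    NetCopy.pendantCornerEdge (IsEmbedding-∘ {Net} {Net} {H} q-net σ) uv (uncovered-∘ {Net} {Net} σ uncovered)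
      (λ q5≡q4 → contradiction (proj₁ (turn-automorphism t) (proj₁ q-net q5≡q4)) λ ())
    where
    σ : IsEmbedding Net Net (turn t ∘ reflect)
    σ = IsEmbedding-∘ {Net} {Net} {Net} (turn-automorphism t) reflect-automorphism

  spokedPentagon-Net : StrictSubgraph Net H → SpokedPentagon 1 (J H)
  spokedPentagon-Net (q , q-net , u , v , uv , uncovered)
    with any? (λ t → q (triangle t) ≟ u) | any? (λ t → q (triangle t) ≟ v)
  ... | yes (t , refl) | _              = triangleCornerEdge q-net t uv uncovered
  ... | no _           | yes (t , refl) =
    triangleCornerEdge q-net t (trans (proj₁ simple _ _) uv) (uncovered-swap Net-undirected uncovered)
  ... | no u-off       | no v-off       =
    NetCopy.awayFromTriangle q-net (edge u v uv) (λ t eq → u-off (t , eq)) (λ t eq → v-off (t , eq))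

spokedPentagons : {G : Graph} → IsSimple G → StrictSubgraph C5 G ⊎ StrictSubgraph Net G →
  ∀ k → SpokedPentagon (suc k) (Jpow (suc k) G)
spokedPentagons G-simple (inj₁ C5⊂G)  zero    = Jump.spokedPentagon-C5 G-simple C5⊂G
spokedPentagons G-simple (inj₂ Net⊂G) zero    = Jump.spokedPentagon-Net G-simple Net⊂G
spokedPentagons G-simple strict       (suc k) =
  Jump.spokedPentagonJ (Jpow-simple G-simple (suc k)) (spokedPentagons G-simple strict k)

mainTheorem15 : (G : Graph) → IsSimple G →
    StrictSubgraph C5 G ⊎ StrictSubgraph Net G → EdgesDiverge G
mainTheorem15 G G-simple strict M = M , λ where
  zero    z≤n → z≤n
  (suc k) M≤k → ≤-trans M≤k (Jump.spokes≤edgeCount (Jpow-simple G-simple (suc k))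
                                (spokedPentagons G-simple strict k))
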